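{- Let $G$ be an $(s,k)$-edge-connected graph with $k\geq 3$ odd, and let $A_1,A_2,A_3$ be three distinct dangerous sets such that for all distinct $i,j\in\{1,2,3\}$: (a) $A_i\cap A_j$ contains at most one neighbour of $s$; (b) $|\delta(A_i\cap A_j:A_j\setminus A_i)|=(k-1)/2$; (c) $|\delta(A_i\setminus A_j:A_j\setminus A_i)|=0$; (d) there are no edges between $A_i\cap A_j$ and $V(G)\setminus(A_i\cup A_j\cup\{s\})$. Then $A_1\cap A_2\cap A_3=\emptyset$.
   Context: All graphs are finite loopless multigraphs. $\delta(X)$ is the set of edges with exactly one end in $X$; for disjoint $X,Y$, $\delta(X:Y)$ is the set of edges with one end in $X$ and the other in $Y$. A graph $G$ is $(s,k)$-edge-connected if $G$ has at least three vertices, $s\in V(G)$, $k$ is a positive integer, and any two vertices of $G$ different from $s$ are joined by $k$ pairwise edge-disjoint paths in $G$ (which may pass through $s$). A set $A\subseteq V(G)\setminus\{s\}$ is dangerous if $A\ne\emptyset$, $V(G)\setminus(A\cup\{s\})\neq\emptyset$ and $|\delta(A)|\le k+1$. -}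

module Defs where

open import Data.Nat using (ℕ; zero; suc; _+_; _≤_)
open import Data.Fin using (Fin)
import Data.Fin as Fin
open import Data.Fin.Subset using (Subset; _∈_; _∉_; _∩_; _─_; _∪_; ∁; ⁅_⁆)
open import Data.Bool using (Bool; true; false; _∧_; _∨_; if_then_else_)
open import Data.Vec using (Vec; lookup)
open import Data.Product using (_×_; _,_; proj₁; proj₂; ∃; ∃-syntax)
open import Data.Sum using (_⊎_)
open import Data.List using (List; []; _∷_)
open import Data.List.Membership.Propositional using () renaming (_∈_ to _∈ₗ_)
open import Data.List.Relation.Unary.Unique.Propositional using (Unique)
open import Relation.Binary.PropositionalEquality using (_≡_; _≢_)
open import Relation.Nullary using (¬_)

record Graph : Set where
  field
    n        : ℕ
    m        : ℕ
    ends     : Fin m → Fin n × Fin n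
    loopless : ∀ e → proj₁ (ends e) ≢ proj₂ (ends e)

countTrue : ∀ {m} → (Fin m → Bool) → ℕ
countTrue {zero}  f = 0
countTrue {suc m} f = (if f Fin.zero then 1 else 0) + countTrue (λ i → f (Fin.suc i))

module _ (G : Graph) where
  open Graph G

  Joins : Fin m → Fin n → Fin n → Set
  Joins e x y = ends e ≡ (x , y) ⊎ ends e ≡ (y , x)

  Adjacent : Fin n → Fin n → Set
  Adjacent x y = ∃[ e ] Joins e x y

  data Walk : Fin n → Fin n → Set where
    []  : ∀ {x} → Walk x x
    _∷⟨_⟩_ : ∀ {x y z} (e : Fin m) → Joins e x y → Walk y z → Walk x z

  walkEdges : ∀ {x z} → Walk x z → List (Fin m)
  walkEdges []            = []
  walkEdges (e ∷⟨ _ ⟩ w) = e ∷ walkEdges w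

  walkVertices : ∀ {x z} → Walk x z → List (Fin n)
  walkVertices {x} []        = x ∷ []
  walkVertices {x} (_ ∷⟨ _ ⟩ w) = x ∷ walkVertices w

  record Path (x z : Fin n) : Set where
    field
      walk     : Walk x z
      distinct : Unique (walkVertices walk)

  EdgeDisjoint : ∀ {x z x' z'} → Path x z → Path x' z' → Set
  EdgeDisjoint p q =
    ∀ e → e ∈ₗ walkEdges (Path.walk p) → ¬ (e ∈ₗ walkEdges (Path.walk q))

  IsSKEdgeConnected : Fin n → ℕ → Set
  IsSKEdgeConnected s k =
    3 ≤ n × 1 ≤ k ×
    (∀ u v → u ≢ s → v ≢ s → u ≢ v →
      ∃ λ (P : Fin k → Path u v) → ∀ i j → i ≢ j → EdgeDisjoint (P i) (P j))

  crosses : Subset n → Subset n → Fin m → Bool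
  crosses X Y e =
    (lookup X (proj₁ (ends e)) ∧ lookup Y (proj₂ (ends e))) ∨
    (lookup Y (proj₁ (ends e)) ∧ lookup X (proj₂ (ends e)))

  edgesBetween : Subset n → Subset n → ℕ
  edgesBetween X Y = countTrue (crosses X Y)

  δ : Subset n → ℕ
  δ X = edgesBetween X (∁ X)

  Dangerous : Fin n → ℕ → Subset n → Set
  Dangerous s k A =
    s ∉ A × (∃[ v ] v ∈ A) × (∃[ v ] (v ≢ s × v ∉ A)) × δ A ≤ k + 1

{-# OPTIONS --safe #-}
module Submission where

-- Suppose v ∈ X = A₀ ∩ A₁ ∩ A₂. Every vertex has a type: its membership in A₀, A₁, A₂
-- and {s}. Besides X, the relevant regions are Bᵢ = (Aⱼ ∩ Aₗ) ∖ Aᵢ and Cᵢ = Aᵢ ∖ (Aⱼ ∪ Aₗ)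
-- ({i, j, l} = {0, 1, 2}). By (c) and (d) the only edges leaving X ∪ B₀ ∪ B₁ ∪ B₂ are
-- counted by xᵢ = |δ(X:Bᵢ)|, yᵢⱼ = |δ(Bᵢ:Cⱼ)|, sX = |δ(X:{s})| and sᵢ = |δ(Bᵢ:{s})|.
-- With k = 2h + 1, hypothesis (b) gives xᵢ + yₗⱼ = h; edge-connectivity gives at least k
-- edges leaving X, X ∪ B₁, X ∪ B₂ and each nonempty Bᵢ; A₀ being dangerous bounds the edges
-- leaving A₀ by k + 1; and by (a), s cannot see both X and Bᵢ ⊆ Aⱼ ∩ Aₗ. These linear
-- constraints are inconsistent. Each inequality between edge counts holds edge by edge and
-- depends only on the types of the two ends, so it is verified by evaluating it on all
-- pairs of types.

open import Defs
open import Data.Bool using (Bool; true; false; T; _∧_; _∨_; not; _xor_; if_then_else_)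
open import Data.Bool.Properties using (∧-zeroʳ; ∧-identityʳ)
open import Data.Empty using (⊥)
open import Data.Fin using (Fin; zero; suc; punchIn; punchOut; _≟_)
import Data.Fin as Fin
open import Data.Fin.Patterns using (0F; 1F; 2F)
open import Data.Fin.Properties
  using (any?; punchIn-injective; punchInᵢ≢i; punchOut-injective; punchIn-punchOut)
open import Data.Fin.Subset using (Subset; _∈_; _∉_; _∩_; _∪_; _─_; ∁; ⁅_⁆)
open import Data.Fin.Subset.Properties using (x∈⁅y⁆⇒x≡y)
open import Data.List using (List; []; _∷_)
open import Data.List.Membership.Propositional using () renaming (_∈_ to _∈ₗ_)
open import Data.List.Relation.Unary.Any using (here; there)
open import Data.Nat using (ℕ; zero; suc; _+_; _*_; _∸_; _≤_; _≤ᵇ_; z≤n; s≤s)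
open import Data.Nat.DivMod using (_/_; _%_; m≡m%n+[m/n]*n; m*n/n≡m)
open import Data.Nat.Properties
  using (≤-refl; ≤-reflexive; ≤-trans; ≤-antisym; <⇒≱; n≮n; 1+n≰n; n≤0⇒n≡0; ≤ᵇ⇒≤;
         +-comm; +-identityʳ; +-cancelʳ-≡; +-cancelˡ-≤; +-cancelʳ-≤; +-mono-≤; +-monoˡ-≤;
         +-monoʳ-≤; +-mono-<; m≤m+n; m≤n+m; m+n≡0⇒m≡0; m+n≡0⇒n≡0; +-0-commutativeMonoid;
         module ≤-Reasoning)
open import Algebra.Properties.CommutativeMonoid.Sum +-0-commutativeMonoid
  using (sum-syntax; sum-cong-≗; ∑-distrib-+; sum-replicate-zero)
open import Data.Nat.Tactic.RingSolver using (solve-∀)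
open import Data.Product using (_×_; _,_; proj₁; proj₂; ∃-syntax)
open import Data.Sum using (_⊎_; inj₁; inj₂)
open import Data.Vec using (_∷_; lookup)
open import Data.Vec.Properties using (lookup-zipWith; lookup-map; []=⇒lookup; lookup⇒[]=)
open import Function using (_∘_)
open import Function.Definitions using (Injective)
open import Relation.Binary.PropositionalEquality
  using (_≡_; _≢_; _≗_; refl; sym; trans; cong; cong₂; subst; subst₂; module ≡-Reasoning)
open import Relation.Nullary using (¬_; yes; no; contradiction)

∧-true : ∀ {a b} → a ∧ b ≡ true → a ≡ true × b ≡ true
∧-true {true} {true} refl = refl , refl

∨-true : ∀ {a b} → a ∨ b ≡ true → a ≡ true ⊎ b ≡ true
∨-true {true}  _    = inj₁ refl
∨-true {false} b≡t = inj₂ b≡t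

lookup-∩ : ∀ {n} (p q : Subset n) x → lookup (p ∩ q) x ≡ lookup p x ∧ lookup q x
lookup-∩ p q x = lookup-zipWith _∧_ x p q

lookup-∪ : ∀ {n} (p q : Subset n) x → lookup (p ∪ q) x ≡ lookup p x ∨ lookup q x
lookup-∪ p q x = lookup-zipWith _∨_ x p q

lookup-∁ : ∀ {n} (p : Subset n) x → lookup (∁ p) x ≡ not (lookup p x)
lookup-∁ p x = lookup-map x not p

lookup-─ : ∀ {n} (p q : Subset n) x → lookup (p ─ q) x ≡ lookup p x ∧ not (lookup q x)
lookup-─ (a ∷ p) (true  ∷ q) zero    = sym (∧-zeroʳ a)
lookup-─ (a ∷ p) (false ∷ q) zero    = sym (∧-identityʳ a)
lookup-─ (_ ∷ p) (_     ∷ q) (suc x) = lookup-─ p q x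

∉⇒lookup≡false : ∀ {n} {p : Subset n} {x} → x ∉ p → lookup p x ≡ false
∉⇒lookup≡false {p = p} {x} x∉p with lookup p x in p[x]
... | true  = contradiction (lookup⇒[]= x p p[x]) x∉p
... | false = refl

indicator : Bool → ℕ
indicator b = if b then 1 else 0

countTrue≡∑ : ∀ {m} (f : Fin m → Bool) → countTrue f ≡ ∑[ i < m ] indicator (f i)
countTrue≡∑ {zero}  f = refl
countTrue≡∑ {suc m} f = cong (indicator (f zero) +_) (countTrue≡∑ (f ∘ suc))

countTrue-cong : ∀ {m} {f g : Fin m → Bool} → f ≗ g → countTrue f ≡ countTrue g
countTrue-cong {zero}  f≗g = refl
countTrue-cong {suc m} f≗g = cong₂ _+_ (cong indicator (f≗g zero)) (countTrue-cong (f≗g ∘ suc))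

countTrue-witness : ∀ {m} (f : Fin m → Bool) → 1 ≤ countTrue f → ∃[ i ] f i ≡ true
countTrue-witness {suc m} f 1≤count with f zero in f0
... | true  = zero , f0
... | false = let i , fi = countTrue-witness (f ∘ suc) 1≤count in suc i , fi

∑-mono-≤ : ∀ {m} {f g : Fin m → ℕ} → (∀ i → f i ≤ g i) → ∑[ i < m ] f i ≤ ∑[ i < m ] g i
∑-mono-≤ {zero}  f≤g = z≤n
∑-mono-≤ {suc m} f≤g = +-mono-≤ (f≤g zero) (∑-mono-≤ (f≤g ∘ suc))

mutual
  injective⇒≤countTrue : ∀ {k m} (P : Fin m → Bool) (ι : Fin k → Fin m) →
    Injective _≡_ _≡_ ι → (∀ i → P (ι i) ≡ true) → k ≤ countTrue P
  injective⇒≤countTrue {zero}  P ι ι-inj Pι = z≤n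
  injective⇒≤countTrue {suc k} {zero} P ι ι-inj Pι with () ← ι zero
  injective⇒≤countTrue {suc k} {suc m} P ι ι-inj Pι with any? (λ i → ι i ≟ zero)
  ... | no 0∉ι = ≤-trans (injective-avoiding-0⇒≤countTrue P ι ι-inj Pι 0∉ι′) (m≤n+m _ _)
    where
    0∉ι′ : ∀ i → zero ≢ ι i
    0∉ι′ i 0≡ιi = 0∉ι (i , sym 0≡ιi)
  ... | yes (i₀ , ιi₀≡0) =
    subst (λ b → suc k ≤ indicator b + countTrue (P ∘ suc)) (sym P0)
      (s≤s (injective-avoiding-0⇒≤countTrue P (ι ∘ punchIn i₀)
              (punchIn-injective i₀ _ _ ∘ ι-inj) (Pι ∘ punchIn i₀) 0∉ι′))
    where
    P0 : P zero ≡ true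
    P0 = subst (λ j → P j ≡ true) ιi₀≡0 (Pι i₀)
    0∉ι′ : ∀ i → zero ≢ ι (punchIn i₀ i)
    0∉ι′ i 0≡ι = punchInᵢ≢i i₀ i (ι-inj (trans (sym 0≡ι) (sym ιi₀≡0)))

  injective-avoiding-0⇒≤countTrue : ∀ {k m} (P : Fin (suc m) → Bool) (ι : Fin k → Fin (suc m)) →
    Injective _≡_ _≡_ ι → (∀ i → P (ι i) ≡ true) → (∀ i → zero ≢ ι i) → k ≤ countTrue (P ∘ suc)
  injective-avoiding-0⇒≤countTrue P ι ι-inj Pι 0∉ι =
    injective⇒≤countTrue (P ∘ suc) (λ i → punchOut (0∉ι i))
      (ι-inj ∘ punchOut-injective (0∉ι _) (0∉ι _))
      (λ i → subst (λ j → P j ≡ true) (sym (punchIn-punchOut (0∉ι i))) (Pι i))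

module _ (G : Graph) where
  open Graph G

  crossesCut : (Fin n → Bool) → Fin m → Bool
  crossesCut S e = S (proj₁ (ends e)) xor S (proj₂ (ends e))

  cutSize : (Fin n → Bool) → ℕ
  cutSize S = countTrue (crossesCut S)

  joins-crossesCut : ∀ (S : Fin n → Bool) {e x y} → Joins G e x y →
    S x ≡ true → S y ≡ false → crossesCut S e ≡ true
  joins-crossesCut S (inj₁ e≡xy) Sx Sy rewrite e≡xy | Sx | Sy = refl
  joins-crossesCut S (inj₂ e≡yx) Sx Sy rewrite e≡yx | Sx | Sy = refl

  walk-crossesCut : ∀ (S : Fin n → Bool) {x z} (p : Walk G x z) → S x ≡ true → S z ≡ false →
    ∃[ e ] e ∈ₗ walkEdges G p × crossesCut S e ≡ true
  walk-crossesCut S [] Sx Sz = contradiction (trans (sym Sx) Sz) λ ()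
  walk-crossesCut S (_∷⟨_⟩_ {y = y} e xy p) Sx Sz with S y in Sy
  ... | true  = let e′ , e′∈p , e′-crosses = walk-crossesCut S p Sy Sz in e′ , there e′∈p , e′-crosses
  ... | false = e , here refl , joins-crossesCut S xy Sx Sy

  k≤cutSize : ∀ {s k} → IsSKEdgeConnected G s k → (S : Fin n → Bool) {u w : Fin n} →
    u ≢ s → w ≢ s → S u ≡ true → S w ≡ false → k ≤ cutSize S
  k≤cutSize (_ , _ , paths) S {u} {w} u≢s w≢s Su Sw =
    injective⇒≤countTrue (crossesCut S) (proj₁ ∘ crossing) crossing-injective (proj₂ ∘ proj₂ ∘ crossing)
    where
    u≢w : u ≢ w
    u≢w refl = contradiction (trans (sym Su) Sw) λ ()
    P = proj₁ (paths u w u≢s w≢s u≢w)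
    crossing : ∀ i → ∃[ e ] e ∈ₗ walkEdges G (Path.walk (P i)) × crossesCut S e ≡ true
    crossing i = walk-crossesCut S (Path.walk (P i)) Su Sw
    crossing-injective : Injective _≡_ _≡_ (proj₁ ∘ crossing)
    crossing-injective {i} {j} same with i ≟ j
    ... | yes i≡j = i≡j
    ... | no  i≢j = contradiction
      (subst (_∈ₗ walkEdges G (Path.walk (P j))) (sym same) (proj₁ (proj₂ (crossing j))))
      (proj₂ (paths u w u≢s w≢s u≢w) i j i≢j _ (proj₁ (proj₂ (crossing i))))

module EdgeCounting (G : Graph) {T : Set} (type : Fin (Graph.n G) → T) where
  open Graph G

  Region : Set
  Region = T → Bool

  EdgeClass : Set
  EdgeClass = T → T → Bool

  between : Region → Region → EdgeClass
  between F H σ τ = (F σ ∧ H τ) ∨ (H σ ∧ F τ)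

  separates : Region → EdgeClass
  separates F σ τ = F σ xor F τ

  touches : Region → EdgeClass
  touches F σ τ = F σ ∨ F τ

  inClass : EdgeClass → Fin m → Bool
  inClass c e = c (type (proj₁ (ends e))) (type (proj₂ (ends e)))

  edges : EdgeClass → ℕ
  edges c = countTrue (inClass c)

  -- No trailing + 0, so that counts of lists are literally the sums in Configuration below.
  count : List EdgeClass → ℕ
  count []           = 0
  count (c ∷ [])     = edges c
  count (c ∷ d ∷ cs) = edges c + count (d ∷ cs)

  multiplicity : List EdgeClass → T → T → ℕ
  multiplicity []       σ τ = 0
  multiplicity (c ∷ cs) σ τ = indicator (c σ τ) + multiplicity cs σ τ

  multiplicityAt : List EdgeClass → Fin m → ℕ
  multiplicityAt cs e = multiplicity cs (type (proj₁ (ends e))) (type (proj₂ (ends e)))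

  count≡∑ : ∀ cs → count cs ≡ ∑[ e < m ] multiplicityAt cs e
  count≡∑ []           = sym (sum-replicate-zero m)
  count≡∑ (c ∷ [])     =
    trans (countTrue≡∑ (inClass c)) (sum-cong-≗ {m} (λ e → sym (+-identityʳ (indicator (inClass c e)))))
  count≡∑ (c ∷ d ∷ cs) = trans (cong₂ _+_ (countTrue≡∑ (inClass c)) (count≡∑ (d ∷ cs)))
                           (sym (∑-distrib-+ (indicator ∘ inClass c) (multiplicityAt (d ∷ cs))))

  count-≤-modulo : ∀ L R Z → count Z ≡ 0 →
    (∀ x y → multiplicity L (type x) (type y)
               ≤ multiplicity R (type x) (type y) + multiplicity Z (type x) (type y)) →
    count L ≤ count R
  count-≤-modulo L R Z count-Z≡0 L≤R+Z = begin
    count L                                    ≡⟨ count≡∑ L ⟩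
    ∑[ e < m ] multiplicityAt L e              ≤⟨ ∑-mono-≤ (λ e → L≤R+Z (proj₁ (ends e)) (proj₂ (ends e))) ⟩
    ∑[ e < m ] (multiplicityAt R e + multiplicityAt Z e)
                                               ≡⟨ ∑-distrib-+ (multiplicityAt R) (multiplicityAt Z) ⟩
    ∑[ e < m ] multiplicityAt R e + ∑[ e < m ] multiplicityAt Z e
                                               ≡⟨ sym (cong₂ _+_ (count≡∑ R) (count≡∑ Z)) ⟩
    count R + count Z                          ≡⟨ cong (count R +_) count-Z≡0 ⟩
    count R + 0                                ≡⟨ +-identityʳ _ ⟩
    count R                                    ∎
    where open ≤-Reasoning

  edgesBetween≡edges : ∀ (P Q : Subset n) (F H : Region) →
    (∀ x → lookup P x ≡ F (type x)) → (∀ x → lookup Q x ≡ H (type x)) →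
    edgesBetween G P Q ≡ edges (between F H)
  edgesBetween≡edges P Q F H P≡F Q≡H = countTrue-cong λ e →
    cong₂ _∨_ (cong₂ _∧_ (P≡F (proj₁ (ends e))) (Q≡H (proj₂ (ends e))))
              (cong₂ _∧_ (Q≡H (proj₁ (ends e))) (P≡F (proj₂ (ends e))))

VertexType : Set
VertexType = Bool × Bool × Bool × Bool

inA : Fin 3 → VertexType → Bool
inA 0F (a , _ , _ , _) = a
inA 1F (_ , b , _ , _) = b
inA 2F (_ , _ , c , _) = c

isS : VertexType → Bool
isS (_ , _ , _ , t) = t

admissible : VertexType → Bool
admissible σ = not (isS σ ∧ (inA 0F σ ∨ inA 1F σ ∨ inA 2F σ))

X : VertexType → Bool
X (a , b , c , _) = a ∧ b ∧ c

B C : Fin 3 → VertexType → Bool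
B 0F (a , b , c , _) = not a ∧ b ∧ c
B 1F (a , b , c , _) = a ∧ not b ∧ c
B 2F (a , b , c , _) = a ∧ b ∧ not c
C 0F (a , b , c , _) = a ∧ not b ∧ not c
C 1F (a , b , c , _) = not a ∧ b ∧ not c
C 2F (a , b , c , _) = not a ∧ not b ∧ c

allBool : (Bool → Bool) → Bool
allBool P = P true ∧ P false

allBool-sound : ∀ P → allBool P ≡ true → ∀ b → P b ≡ true
allBool-sound P all true  = proj₁ (∧-true all)
allBool-sound P all false = proj₂ (∧-true all)

allTypes : (VertexType → Bool) → Bool
allTypes P = allBool λ a → allBool λ b → allBool λ c → allBool λ t → P (a , b , c , t)

allTypes-sound : ∀ P → allTypes P ≡ true → ∀ σ → P σ ≡ true
allTypes-sound P all (a , b , c , t) =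
  allBool-sound (λ t → P (a , b , c , t))
    (allBool-sound (λ c → allBool λ t → P (a , b , c , t))
      (allBool-sound (λ b → allBool λ c → allBool λ t → P (a , b , c , t))
        (allBool-sound (λ a → allBool λ b → allBool λ c → allBool λ t → P (a , b , c , t)) all a) b) c) t

_⇒ᵇ_ : (VertexType → Bool) → (VertexType → Bool) → Bool
F ⇒ᵇ H = allTypes λ σ → not (F σ) ∨ H σ

⇒ᵇ-sound : ∀ F H → (F ⇒ᵇ H) ≡ true → ∀ σ → F σ ≡ true → H σ ≡ true
⇒ᵇ-sound F H F⇒H σ Fσ with F σ | H σ | allTypes-sound (λ σ → not (F σ) ∨ H σ) F⇒H σ
... | true | true | _ = refl

⇒ᵇ-sound-false : ∀ F H → (F ⇒ᵇ H) ≡ true → ∀ σ → H σ ≡ false → F σ ≡ false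
⇒ᵇ-sound-false F H F⇒H σ Hσ with F σ | H σ | allTypes-sound (λ σ → not (F σ) ∨ H σ) F⇒H σ
... | false | false | _ = refl

ZeroOrAtLeast : ℕ → ℕ → Set
ZeroOrAtLeast k t = t ≡ 0 ⊎ k ≤ t

record Configuration (h : ℕ) : Set where
  field
    x₀ x₁ x₂ y₀₁ y₀₂ y₁₀ y₁₂ y₂₀ y₂₁ sX s₀ s₁ s₂ : ℕ
    1≤h      : 1 ≤ h
    pair₀₁   : x₀ + y₂₁ ≡ h
    pair₀₂   : x₀ + y₁₂ ≡ h
    pair₁₀   : x₁ + y₂₀ ≡ h
    pair₁₂   : x₁ + y₀₂ ≡ h
    pair₂₀   : x₂ + y₁₀ ≡ h
    pair₂₁   : x₂ + y₀₁ ≡ h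
    cut-X    : suc (h + h) ≤ x₀ + (x₁ + (x₂ + sX))
    cut-X∪B₁ : suc (h + h) ≤ x₀ + (x₂ + (y₁₀ + (y₁₂ + (sX + s₁))))
    cut-X∪B₂ : suc (h + h) ≤ x₀ + (x₁ + (y₂₀ + (y₂₁ + (sX + s₂))))
    cut-B₀   : ZeroOrAtLeast (suc (h + h)) (x₀ + (y₀₁ + (y₀₂ + s₀)))
    cut-B₁   : ZeroOrAtLeast (suc (h + h)) (x₁ + (y₁₀ + (y₁₂ + s₁)))
    cut-B₂   : ZeroOrAtLeast (suc (h + h)) (x₂ + (y₂₀ + (y₂₁ + s₂)))
    cut-A₀   : x₀ + (y₂₁ + (y₁₂ + (sX + (s₁ + s₂)))) ≤ suc (suc (h + h))
    single₀  : 1 ≤ sX → s₀ ≡ 0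
    single₁  : 1 ≤ sX → s₁ ≡ 0
    single₂  : 1 ≤ sX → s₂ ≡ 0

balance : ∀ {h} x xⱼ xₗ y′ y″ {s} → xⱼ + y″ ≡ h → xₗ + y′ ≡ h → s ≡ 0 →
  x + (y′ + (y″ + s)) + (xⱼ + xₗ) ≡ h + h + x
balance {h} x xⱼ xₗ y′ y″ xⱼy″≡h xₗy′≡h refl = begin
  x + (y′ + (y″ + 0)) + (xⱼ + xₗ) ≡⟨ regroup x xⱼ xₗ y′ y″ ⟩
  (xⱼ + y″) + (xₗ + y′) + x       ≡⟨ cong₂ (λ a b → a + b + x) xⱼy″≡h xₗy′≡h ⟩
  h + h + x                       ∎
  where
  open ≡-Reasoning
  regroup : ∀ x xⱼ xₗ y′ y″ → x + (y′ + (y″ + 0)) + (xⱼ + xₗ) ≡ (xⱼ + y″) + (xₗ + y′) + x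
  regroup = solve-∀

balance⇒2h : ∀ {h} t a b {c} → t + (a + b) ≡ h + h + c → a + b ≡ h → c ≡ h → t ≡ h + h
balance⇒2h {h} t a b bal ab≡h refl = +-cancelʳ-≡ h t (h + h) (trans (cong (t +_) (sym ab≡h)) bal)

balances⇒sum≤4h : ∀ {h} t₀ t₁ x₀ x₁ x₂ →
  t₀ + (x₁ + x₂) ≡ h + h + x₀ → t₁ + (x₀ + x₂) ≡ h + h + x₁ → t₀ + t₁ ≤ (h + h) + (h + h)
balances⇒sum≤4h {h} t₀ t₁ x₀ x₁ x₂ bal₀ bal₁ =
  +-cancelʳ-≤ (x₀ + x₁) (t₀ + t₁) ((h + h) + (h + h)) (begin
    t₀ + t₁ + (x₀ + x₁)                     ≤⟨ +-monoʳ-≤ (t₀ + t₁) (m≤n+m (x₀ + x₁) (x₂ + x₂)) ⟩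
    t₀ + t₁ + (x₂ + x₂ + (x₀ + x₁))         ≡⟨ regroup t₀ t₁ x₀ x₁ x₂ ⟩
    (t₀ + (x₁ + x₂)) + (t₁ + (x₀ + x₂))     ≡⟨ cong₂ _+_ bal₀ bal₁ ⟩
    (h + h + x₀) + (h + h + x₁)             ≡⟨ regroup′ h x₀ x₁ ⟩
    (h + h) + (h + h) + (x₀ + x₁)           ∎)
  where
  open ≤-Reasoning
  regroup : ∀ t₀ t₁ x₀ x₁ x₂ → t₀ + t₁ + (x₂ + x₂ + (x₀ + x₁)) ≡ (t₀ + (x₁ + x₂)) + (t₁ + (x₀ + x₂))
  regroup = solve-∀
  regroup′ : ∀ h x₀ x₁ → (h + h + x₀) + (h + h + x₁) ≡ (h + h) + (h + h) + (x₀ + x₁)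
  regroup′ = solve-∀

sum≡0⇒parts≡0 : ∀ x y′ y″ {s} → x + (y′ + (y″ + s)) ≡ 0 → x ≡ 0 × y′ ≡ 0 × y″ ≡ 0 × s ≡ 0
sum≡0⇒parts≡0 x y′ y″ sum≡0 =
  m+n≡0⇒m≡0 x sum≡0 , m+n≡0⇒m≡0 y′ rest≡0 ,
  m+n≡0⇒m≡0 y″ (m+n≡0⇒n≡0 y′ rest≡0) , m+n≡0⇒n≡0 y″ (m+n≡0⇒n≡0 y′ rest≡0)
  where
  rest≡0 = m+n≡0⇒n≡0 x sum≡0

pair-with-0 : ∀ {h} x {y} → x + y ≡ h → y ≡ 0 → x ≡ h
pair-with-0 x xy≡h refl = trans (sym (+-identityʳ x)) xy≡h

2h-not-ZeroOrAtLeast : ∀ {h t} → 1 ≤ h → t ≡ h + h → ¬ ZeroOrAtLeast (suc (h + h)) t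
2h-not-ZeroOrAtLeast {suc h} _ refl (inj₂ 2h<2h) = 1+n≰n 2h<2h

-- If s sees X then s₀ = s₁ = s₂ = 0, and the pair equations give Tᵢ + xⱼ + xₗ = 2h + xᵢ
-- for the boundary Tᵢ of Bᵢ. An empty Bₗ forces xₗ = 0 and xᵢ = xⱼ = h, hence Tᵢ = 2h; otherwise two of
-- the boundaries are at least k each, while T₀ + T₁ ≤ 4h.
s-adjacent-to-X⇒⊥ : ∀ {h} (cfg : Configuration h) → 1 ≤ Configuration.sX cfg → ⊥
s-adjacent-to-X⇒⊥ {h} cfg 1≤sX = cases cut-B₀ cut-B₁ cut-B₂
  where
  open Configuration cfg
  T₀ T₁ T₂ : ℕ
  T₀ = x₀ + (y₀₁ + (y₀₂ + s₀))
  T₁ = x₁ + (y₁₀ + (y₁₂ + s₁))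
  T₂ = x₂ + (y₂₀ + (y₂₁ + s₂))

  balance₀ : T₀ + (x₁ + x₂) ≡ h + h + x₀
  balance₀ = balance x₀ x₁ x₂ y₀₁ y₀₂ pair₁₂ pair₂₁ (single₀ 1≤sX)
  balance₁ : T₁ + (x₀ + x₂) ≡ h + h + x₁
  balance₁ = balance x₁ x₀ x₂ y₁₀ y₁₂ pair₀₂ pair₂₀ (single₁ 1≤sX)

  T₂≡0⇒T₀≡2h : T₂ ≡ 0 → T₀ ≡ h + h
  T₂≡0⇒T₀≡2h T₂≡0 with sum≡0⇒parts≡0 x₂ y₂₀ y₂₁ T₂≡0
  ... | x₂≡0 , y₂₀≡0 , y₂₁≡0 , _ = balance⇒2h T₀ x₁ x₂ balance₀
    (trans (cong₂ _+_ (pair-with-0 x₁ pair₁₀ y₂₀≡0) x₂≡0) (+-identityʳ h)) (pair-with-0 x₀ pair₀₁ y₂₁≡0)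
  T₁≡0⇒T₀≡2h : T₁ ≡ 0 → T₀ ≡ h + h
  T₁≡0⇒T₀≡2h T₁≡0 with sum≡0⇒parts≡0 x₁ y₁₀ y₁₂ T₁≡0
  ... | x₁≡0 , y₁₀≡0 , y₁₂≡0 , _ = balance⇒2h T₀ x₁ x₂ balance₀
    (cong₂ _+_ x₁≡0 (pair-with-0 x₂ pair₂₀ y₁₀≡0)) (pair-with-0 x₀ pair₀₂ y₁₂≡0)
  T₀≡0⇒T₁≡2h : T₀ ≡ 0 → T₁ ≡ h + h
  T₀≡0⇒T₁≡2h T₀≡0 with sum≡0⇒parts≡0 x₀ y₀₁ y₀₂ T₀≡0
  ... | x₀≡0 , y₀₁≡0 , y₀₂≡0 , _ = balance⇒2h T₁ x₀ x₂ balance₁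
    (cong₂ _+_ x₀≡0 (pair-with-0 x₂ pair₂₁ y₀₁≡0)) (pair-with-0 x₁ pair₁₂ y₀₂≡0)

  cases : ZeroOrAtLeast (suc (h + h)) T₀ → ZeroOrAtLeast (suc (h + h)) T₁ →
          ZeroOrAtLeast (suc (h + h)) T₂ → ⊥
  cases cut₀        _           (inj₁ T₂≡0) = 2h-not-ZeroOrAtLeast 1≤h (T₂≡0⇒T₀≡2h T₂≡0) cut₀
  cases cut₀        (inj₁ T₁≡0) _           = 2h-not-ZeroOrAtLeast 1≤h (T₁≡0⇒T₀≡2h T₁≡0) cut₀
  cases (inj₁ T₀≡0) cut₁        _           = 2h-not-ZeroOrAtLeast 1≤h (T₀≡0⇒T₁≡2h T₀≡0) cut₁
  cases (inj₂ k≤T₀) (inj₂ k≤T₁) _           = <⇒≱ (+-mono-< ≤-refl ≤-refl)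
    (≤-trans (+-mono-≤ k≤T₀ k≤T₁) (balances⇒sum≤4h {h} T₀ T₁ x₀ x₁ x₂ balance₀ balance₁))

1≤remainder : ∀ {h} a b c d r → suc (h + h) ≤ a + (b + (c + (d + r))) → a + d ≡ h → b + c ≡ h → 1 ≤ r
1≤remainder {h} a b c d zero k≤sum ad≡h bc≡h =
  contradiction (subst (suc (h + h) ≤_) (trans (regroup a b c d) (cong₂ _+_ ad≡h bc≡h)) k≤sum) 1+n≰n
  where
  regroup : ∀ a b c d → a + (b + (c + (d + 0))) ≡ (a + d) + (b + c)
  regroup = solve-∀
1≤remainder a b c d (suc r) _ _ _ = s≤s z≤n

nonzero⇒atLeast : ∀ {k} x y′ y″ {s} → 1 ≤ s →
  ZeroOrAtLeast k (x + (y′ + (y″ + s))) → k ≤ x + (y′ + (y″ + s))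
nonzero⇒atLeast x y′ y″ 1≤s (inj₁ sum≡0)
  with () ← subst (1 ≤_) (proj₂ (proj₂ (proj₂ (sum≡0⇒parts≡0 x y′ y″ sum≡0)))) 1≤s
nonzero⇒atLeast x y′ y″ 1≤s (inj₂ k≤sum) = k≤sum

-- Without edges from s to X, the cuts around X ∪ B₁ and X ∪ B₂ need s₁, s₂ ≥ 1, so B₁ and
-- B₂ have boundaries of size at least k; with the bound on δ(A₀) this leaves x₀ = 0, and
-- then the boundary of X has at most x₁ + x₂ ≤ 2h edges.
s-not-adjacent-to-X⇒⊥ : ∀ {h} (cfg : Configuration h) → Configuration.sX cfg ≡ 0 → ⊥
s-not-adjacent-to-X⇒⊥ {h} cfg sX≡0 = n≮n (h + h) (begin-strict
  h + h                                       <⟨ cut-X ⟩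
  x₀ + (x₁ + (x₂ + sX))                       ≤⟨ m≤m+n _ (y₂₀ + y₁₀) ⟩
  x₀ + (x₁ + (x₂ + sX)) + (y₂₀ + y₁₀)         ≡⟨ regroup x₀ x₁ x₂ sX y₂₀ y₁₀ ⟩
  (x₀ + sX) + ((x₁ + y₂₀) + (x₂ + y₁₀))       ≡⟨ cong₂ _+_ x₀+sX≡0 (cong₂ _+_ pair₁₀ pair₂₀) ⟩
  h + h                                       ∎)
  where
  open Configuration cfg
  open ≤-Reasoning
  k≤T₁ : suc (h + h) ≤ x₁ + (y₁₀ + (y₁₂ + s₁))
  k≤T₁ = nonzero⇒atLeast x₁ y₁₀ y₁₂
    (subst (λ t → 1 ≤ t + s₁) sX≡0 (1≤remainder x₀ x₂ y₁₀ y₁₂ (sX + s₁) cut-X∪B₁ pair₀₂ pair₂₀)) cut-B₁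
  k≤T₂ : suc (h + h) ≤ x₂ + (y₂₀ + (y₂₁ + s₂))
  k≤T₂ = nonzero⇒atLeast x₂ y₂₀ y₂₁
    (subst (λ t → 1 ≤ t + s₂) sX≡0 (1≤remainder x₀ x₁ y₂₀ y₂₁ (sX + s₂) cut-X∪B₂ pair₀₁ pair₁₀)) cut-B₂
  regroup-T : ∀ x₀ x₁ x₂ y₁₀ y₁₂ y₂₀ y₂₁ sX s₁ s₂ →
    x₁ + (y₁₀ + (y₁₂ + s₁)) + (x₂ + (y₂₀ + (y₂₁ + s₂))) + (x₀ + sX) ≡
    (x₁ + y₂₀) + (x₂ + y₁₀) + (x₀ + (y₂₁ + (y₁₂ + (sX + (s₁ + s₂)))))
  regroup-T = solve-∀
  regroup-2k : ∀ h → h + h + suc (suc (h + h)) ≡ suc (h + h) + suc (h + h) + 0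
  regroup-2k = solve-∀
  x₀+sX≤0 : x₀ + sX ≤ 0
  x₀+sX≤0 = +-cancelˡ-≤ (suc (h + h) + suc (h + h)) (x₀ + sX) 0 (begin
    suc (h + h) + suc (h + h) + (x₀ + sX)
      ≤⟨ +-monoˡ-≤ (x₀ + sX) (+-mono-≤ k≤T₁ k≤T₂) ⟩
    x₁ + (y₁₀ + (y₁₂ + s₁)) + (x₂ + (y₂₀ + (y₂₁ + s₂))) + (x₀ + sX)
      ≡⟨ regroup-T x₀ x₁ x₂ y₁₀ y₁₂ y₂₀ y₂₁ sX s₁ s₂ ⟩
    (x₁ + y₂₀) + (x₂ + y₁₀) + (x₀ + (y₂₁ + (y₁₂ + (sX + (s₁ + s₂)))))
      ≤⟨ +-mono-≤ (≤-reflexive (cong₂ _+_ pair₁₀ pair₂₀)) cut-A₀ ⟩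
    h + h + suc (suc (h + h))
      ≡⟨ regroup-2k h ⟩
    suc (h + h) + suc (h + h) + 0 ∎)
  x₀+sX≡0 : x₀ + sX ≡ 0
  x₀+sX≡0 = n≤0⇒n≡0 x₀+sX≤0
  regroup : ∀ x₀ x₁ x₂ sX y₂₀ y₁₀ →
    x₀ + (x₁ + (x₂ + sX)) + (y₂₀ + y₁₀) ≡ (x₀ + sX) + ((x₁ + y₂₀) + (x₂ + y₁₀))
  regroup = solve-∀

no-configuration : ∀ {h} → ¬ Configuration h
no-configuration cfg with Configuration.sX cfg in sX≡
... | zero  = s-not-adjacent-to-X⇒⊥ cfg sX≡
... | suc _ = s-adjacent-to-X⇒⊥ cfg (subst (1 ≤_) (sym sX≡) (s≤s z≤n))

module ThreeSets (G : Graph) (s : Fin (Graph.n G)) (A : Fin 3 → Subset (Graph.n G))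
                 (s∉A : ∀ i → s ∉ A i) where
  open Graph G

  type : Fin n → VertexType
  type x = lookup (A 0F) x , lookup (A 1F) x , lookup (A 2F) x , lookup ⁅ s ⁆ x

  open EdgeCounting G type public

  lookup-A : ∀ i x → lookup (A i) x ≡ inA i (type x)
  lookup-A 0F x = refl
  lookup-A 1F x = refl
  lookup-A 2F x = refl

  isS⇒≡s : ∀ {x} → isS (type x) ≡ true → x ≡ s
  isS⇒≡s {x} x∈⁅s⁆ = x∈⁅y⁆⇒x≡y s (lookup⇒[]= x ⁅ s ⁆ x∈⁅s⁆)

  inA⇒≢s : ∀ i {x} → inA i (type x) ≡ true → x ≢ s
  inA⇒≢s i {x} x∈Aᵢ refl =
    contradiction (trans (sym x∈Aᵢ) (trans (sym (lookup-A i s)) (∉⇒lookup≡false (s∉A i)))) λ ()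

  type-admissible : ∀ x → admissible (type x) ≡ true
  type-admissible x with lookup ⁅ s ⁆ x in x∈⁅s⁆
  ... | false = refl
  ... | true with refl ← isS⇒≡s {x} x∈⁅s⁆
    rewrite ∉⇒lookup≡false (s∉A 0F) | ∉⇒lookup≡false (s∉A 1F) | ∉⇒lookup≡false (s∉A 2F) = refl

  ∈⋂⇒X : ∀ {v} → v ∈ A 0F ∩ A 1F ∩ A 2F → X (type v) ≡ true
  ∈⋂⇒X {v} v∈⋂ = trans (sym (trans (lookup-∩ (A 0F) (A 1F ∩ A 2F) v)
                                   (cong (lookup (A 0F) v ∧_) (lookup-∩ (A 1F) (A 2F) v))))
                        ([]=⇒lookup v∈⋂)

  shared only outside : Fin 3 → Fin 3 → Region
  shared  i j σ = inA i σ ∧ inA j σ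
  only    i j σ = inA i σ ∧ not (inA j σ)
  outside i j σ = not (inA i σ ∨ (inA j σ ∨ isS σ))

  lookup-shared : ∀ i j x → lookup (A i ∩ A j) x ≡ shared i j (type x)
  lookup-shared i j x = trans (lookup-∩ (A i) (A j) x) (cong₂ _∧_ (lookup-A i x) (lookup-A j x))

  lookup-only : ∀ i j x → lookup (A i ─ A j) x ≡ only i j (type x)
  lookup-only i j x = trans (lookup-─ (A i) (A j) x) (cong₂ _∧_ (lookup-A i x) (cong not (lookup-A j x)))

  lookup-outside : ∀ i j x → lookup (∁ (A i ∪ A j ∪ ⁅ s ⁆)) x ≡ outside i j (type x)
  lookup-outside i j x = begin
    lookup (∁ (A i ∪ A j ∪ ⁅ s ⁆)) x
      ≡⟨ lookup-∁ (A i ∪ A j ∪ ⁅ s ⁆) x ⟩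
    not (lookup (A i ∪ A j ∪ ⁅ s ⁆) x)
      ≡⟨ cong not (lookup-∪ (A i) (A j ∪ ⁅ s ⁆) x) ⟩
    not (lookup (A i) x ∨ lookup (A j ∪ ⁅ s ⁆) x)
      ≡⟨ cong (λ b → not (lookup (A i) x ∨ b)) (lookup-∪ (A j) ⁅ s ⁆ x) ⟩
    not (lookup (A i) x ∨ (lookup (A j) x ∨ isS (type x)))
      ≡⟨ cong₂ (λ a b → not (a ∨ (b ∨ isS (type x)))) (lookup-A i x) (lookup-A j x) ⟩
    outside i j (type x) ∎
    where open ≡-Reasoning

  edgesBetween-shared-only : ∀ i j →
    edgesBetween G (A i ∩ A j) (A j ─ A i) ≡ edges (between (shared i j) (only j i))
  edgesBetween-shared-only i j =
    edgesBetween≡edges (A i ∩ A j) (A j ─ A i) (shared i j) (only j i) (lookup-shared i j) (lookup-only j i)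

  edgesBetween-only-only : ∀ i j →
    edgesBetween G (A i ─ A j) (A j ─ A i) ≡ edges (between (only i j) (only j i))
  edgesBetween-only-only i j =
    edgesBetween≡edges (A i ─ A j) (A j ─ A i) (only i j) (only j i) (lookup-only i j) (lookup-only j i)

  edgesBetween-shared-outside : ∀ i j →
    edgesBetween G (A i ∩ A j) (∁ (A i ∪ A j ∪ ⁅ s ⁆)) ≡ edges (between (shared i j) (outside i j))
  edgesBetween-shared-outside i j =
    edgesBetween≡edges (A i ∩ A j) (∁ (A i ∪ A j ∪ ⁅ s ⁆)) (shared i j) (outside i j)
      (lookup-shared i j) (lookup-outside i j)

  δ-A₀ : δ G (A 0F) ≡ edges (between (inA 0F) (not ∘ inA 0F))
  δ-A₀ = edgesBetween≡edges (A 0F) (∁ (A 0F)) (inA 0F) (not ∘ inA 0F) (λ _ → refl) (lookup-∁ (A 0F))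

  module Bounds (h : ℕ) (1≤h : 1 ≤ h) (conn : IsSKEdgeConnected G s (suc (h + h)))
    (unique : ∀ i j → i ≢ j → ∀ u v → u ∈ (A i ∩ A j) → v ∈ (A i ∩ A j) →
                Adjacent G s u → Adjacent G s v → u ≡ v)
    (shared-only : ∀ i j → i ≢ j → edges (between (shared i j) (only j i)) ≡ h)
    (only-only : ∀ i j → i ≢ j → edges (between (only i j) (only j i)) ≡ 0)
    (shared-outside : ∀ i j → i ≢ j → edges (between (shared i j) (outside i j)) ≡ 0)
    (δA₀≤ : edges (between (inA 0F) (not ∘ inA 0F)) ≤ suc (suc (h + h)))
    {v w : Fin n} (v∈X : X (type v) ≡ true) (w≢s : w ≢ s) (w∉A₀ : inA 0F (type w) ≡ false) where

    null : List EdgeClass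
    null = between (only 0F 1F) (only 1F 0F) ∷ between (only 0F 2F) (only 2F 0F)
         ∷ between (only 1F 2F) (only 2F 1F) ∷ between (shared 0F 1F) (outside 0F 1F)
         ∷ between (shared 0F 2F) (outside 0F 2F) ∷ between (shared 1F 2F) (outside 1F 2F) ∷ []

    count-null : count null ≡ 0
    count-null =
      cong₂ _+_ (only-only 0F 1F λ ()) (cong₂ _+_ (only-only 0F 2F λ ()) (cong₂ _+_ (only-only 1F 2F λ ())
        (cong₂ _+_ (shared-outside 0F 1F λ ()) (cong₂ _+_ (shared-outside 0F 2F λ ())
          (shared-outside 1F 2F λ ())))))

    dominated : List EdgeClass → List EdgeClass → Bool
    dominated L R = allTypes λ σ → allTypes λ τ →
      not (admissible σ ∧ admissible τ) ∨ (multiplicity L σ τ ≤ᵇ multiplicity R σ τ + multiplicity null σ τ)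

    count-≤ : ∀ L R → dominated L R ≡ true → count L ≤ count R
    count-≤ L R L≼R = count-≤-modulo L R null count-null pointwise
      where
      checked : VertexType → VertexType → Bool
      checked σ τ = not (admissible σ ∧ admissible τ)
                    ∨ (multiplicity L σ τ ≤ᵇ multiplicity R σ τ + multiplicity null σ τ)
      admissible-check : ∀ {a b c} → a ≡ true → b ≡ true → not (a ∧ b) ∨ c ≡ true → c ≡ true
      admissible-check refl refl c≡true = c≡true
      pointwise : ∀ x y → multiplicity L (type x) (type y)
                            ≤ multiplicity R (type x) (type y) + multiplicity null (type x) (type y)
      pointwise x y = ≤ᵇ⇒≤ _ _ (subst T (sym (admissible-check (type-admissible x) (type-admissible y)
        (allTypes-sound (checked (type x))
          (allTypes-sound (λ σ → allTypes (checked σ)) L≼R (type x)) (type y)))) _)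

    count-≡ : ∀ L R → dominated L R ≡ true → dominated R L ≡ true → count L ≡ count R
    count-≡ L R L≼R R≼L = ≤-antisym (count-≤ L R L≼R) (count-≤ R L R≼L)

    k≤separates : ∀ F {u w} → u ≢ s → w ≢ s → F (type u) ≡ true → F (type w) ≡ false →
      suc (h + h) ≤ edges (separates F)
    k≤separates F = k≤cutSize G conn (F ∘ type)

    v≢s : v ≢ s
    v≢s = inA⇒≢s 0F (⇒ᵇ-sound X (inA 0F) refl (type v) v∈X)

    touching-end : ∀ F e → inClass (touches F) e ≡ true → ∃[ x ] F (type x) ≡ true
    touching-end F e touching with ∨-true touching
    ... | inj₁ F-first  = proj₁ (ends e) , F-first
    ... | inj₂ F-second = proj₂ (ends e) , F-second

    -- F may be empty, so only an edge touching F provides a vertex of F to separate from v.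
    boundary-zero-or-k : ∀ F L j → (F ⇒ᵇ inA j) ≡ true → F (type v) ≡ false →
      dominated L (touches F ∷ []) ≡ true → dominated (separates F ∷ []) L ≡ true →
      ZeroOrAtLeast (suc (h + h)) (count L)
    boundary-zero-or-k F L j F⊆Aⱼ v∉F L≼touches separates≼L with edges (touches F) in #touches
    ... | zero  = inj₁ (n≤0⇒n≡0 (subst (count L ≤_) #touches (count-≤ L (touches F ∷ []) L≼touches)))
    ... | suc _ = inj₂ (≤-trans (k≤separates F (inA⇒≢s j (⇒ᵇ-sound F (inA j) F⊆Aⱼ _ Fu)) v≢s Fu v∉F)
                                 (count-≤ (separates F ∷ []) L separates≼L))
      where
      touching = countTrue-witness (inClass (touches F)) (subst (1 ≤_) (sym #touches) (s≤s z≤n))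
      u  = proj₁ (touching-end F (proj₁ touching) (proj₂ touching))
      Fu = proj₂ (touching-end F (proj₁ touching) (proj₂ touching))

    neighbour-of-s : ∀ F → 1 ≤ edges (between F isS) → ∃[ x ] F (type x) ≡ true × Adjacent G s x
    neighbour-of-s F 1≤#F with countTrue-witness (inClass (between F isS)) 1≤#F
    ... | e , e∈F∶s with ∨-true e∈F∶s
    ...   | inj₁ F∶s with ∧-true F∶s
    ...     | F-first , s-second =
      proj₁ (ends e) , F-first , e , inj₂ (cong (proj₁ (ends e) ,_) (isS⇒≡s s-second))
    neighbour-of-s F 1≤#F | e , _ | inj₂ s∶F with ∧-true s∶F
    ...     | s-first , F-second =
      proj₂ (ends e) , F-second , e , inj₁ (cong (_, proj₂ (ends e)) (isS⇒≡s s-first))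

    at-most-one-neighbour : ∀ i j → i ≢ j → ∀ F H →
      (F ⇒ᵇ shared i j) ≡ true → (H ⇒ᵇ shared i j) ≡ true → (F ⇒ᵇ (not ∘ H)) ≡ true →
      1 ≤ edges (between F isS) → edges (between H isS) ≡ 0
    at-most-one-neighbour i j i≢j F H F⊆Aᵢ∩Aⱼ H⊆Aᵢ∩Aⱼ F∩H≡∅ 1≤#F with edges (between H isS) in #H
    ... | zero  = refl
    ... | suc _ = contradiction (trans (sym (cong not Ht)) not-Ht) λ ()
      where
      u-neighbour = neighbour-of-s F 1≤#F
      t-neighbour = neighbour-of-s H (subst (1 ≤_) (sym #H) (s≤s z≤n))
      u = proj₁ u-neighbour
      t = proj₁ t-neighbour
      Fu = proj₁ (proj₂ u-neighbour)
      Ht = proj₁ (proj₂ t-neighbour)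
      member : ∀ K {x} → (K ⇒ᵇ shared i j) ≡ true → K (type x) ≡ true → x ∈ A i ∩ A j
      member K {x} K⊆Aᵢ∩Aⱼ Kx =
        lookup⇒[]= x (A i ∩ A j) (trans (lookup-shared i j x) (⇒ᵇ-sound K (shared i j) K⊆Aᵢ∩Aⱼ _ Kx))
      u≡t : u ≡ t
      u≡t = unique i j i≢j u t (member F F⊆Aᵢ∩Aⱼ Fu) (member H H⊆Aᵢ∩Aⱼ Ht)
                   (proj₂ (proj₂ u-neighbour)) (proj₂ (proj₂ t-neighbour))
      not-Ht : not (H (type t)) ≡ true
      not-Ht = ⇒ᵇ-sound F (not ∘ H) F∩H≡∅ (type t) (subst (λ x → F (type x) ≡ true) u≡t Fu)

    X∶B : Fin 3 → EdgeClass
    X∶B i = between X (B i)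
    B∶C : Fin 3 → Fin 3 → EdgeClass
    B∶C i j = between (B i) (C j)
    X∶s : EdgeClass
    X∶s = between X isS
    B∶s : Fin 3 → EdgeClass
    B∶s i = between (B i) isS

    pair : ∀ i j L → i ≢ j → dominated L (between (shared i j) (only j i) ∷ []) ≡ true →
      dominated (between (shared i j) (only j i) ∷ []) L ≡ true → count L ≡ h
    pair i j L i≢j L≼ ≼L =
      trans (count-≡ L (between (shared i j) (only j i) ∷ []) L≼ ≼L) (shared-only i j i≢j)

    cut-X∪B : ∀ i L → dominated (separates (λ σ → X σ ∨ B i σ) ∷ []) L ≡ true →
      ((λ σ → X σ ∨ B i σ) ⇒ᵇ inA 0F) ≡ true → suc (h + h) ≤ count L
    cut-X∪B i L separates≼L X∪Bᵢ⊆A₀ = ≤-trans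
      (k≤separates (λ σ → X σ ∨ B i σ) v≢s w≢s (cong (_∨ B i (type v)) v∈X)
        (⇒ᵇ-sound-false (λ σ → X σ ∨ B i σ) (inA 0F) X∪Bᵢ⊆A₀ (type w) w∉A₀))
      (count-≤ (separates (λ σ → X σ ∨ B i σ) ∷ []) L separates≼L)

    v∉B : ∀ i → (B i ⇒ᵇ (not ∘ X)) ≡ true → B i (type v) ≡ false
    v∉B i Bᵢ∩X≡∅ = ⇒ᵇ-sound-false (B i) (not ∘ X) Bᵢ∩X≡∅ (type v) (cong not v∈X)

    -- Each refl below is a check evaluated over all (pairs of) vertex types.
    configuration : Configuration h
    configuration = record
      { x₀ = edges (X∶B 0F) ; x₁ = edges (X∶B 1F) ; x₂ = edges (X∶B 2F)
      ; y₀₁ = edges (B∶C 0F 1F) ; y₀₂ = edges (B∶C 0F 2F) ; y₁₀ = edges (B∶C 1F 0F)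
      ; y₁₂ = edges (B∶C 1F 2F) ; y₂₀ = edges (B∶C 2F 0F) ; y₂₁ = edges (B∶C 2F 1F)
      ; sX = edges X∶s ; s₀ = edges (B∶s 0F) ; s₁ = edges (B∶s 1F) ; s₂ = edges (B∶s 2F)
      ; 1≤h = 1≤h
      ; pair₀₁ = pair 0F 1F (X∶B 0F ∷ B∶C 2F 1F ∷ []) (λ ()) refl refl
      ; pair₀₂ = pair 0F 2F (X∶B 0F ∷ B∶C 1F 2F ∷ []) (λ ()) refl refl
      ; pair₁₀ = pair 1F 0F (X∶B 1F ∷ B∶C 2F 0F ∷ []) (λ ()) refl refl
      ; pair₁₂ = pair 1F 2F (X∶B 1F ∷ B∶C 0F 2F ∷ []) (λ ()) refl refl
      ; pair₂₀ = pair 2F 0F (X∶B 2F ∷ B∶C 1F 0F ∷ []) (λ ()) refl refl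
      ; pair₂₁ = pair 2F 1F (X∶B 2F ∷ B∶C 0F 1F ∷ []) (λ ()) refl refl
      ; cut-X = ≤-trans (k≤separates X v≢s w≢s v∈X (⇒ᵇ-sound-false X (inA 0F) refl (type w) w∉A₀))
                        (count-≤ (separates X ∷ []) (X∶B 0F ∷ X∶B 1F ∷ X∶B 2F ∷ X∶s ∷ []) refl)
      ; cut-X∪B₁ = cut-X∪B 1F (X∶B 0F ∷ X∶B 2F ∷ B∶C 1F 0F ∷ B∶C 1F 2F ∷ X∶s ∷ B∶s 1F ∷ []) refl refl
      ; cut-X∪B₂ = cut-X∪B 2F (X∶B 0F ∷ X∶B 1F ∷ B∶C 2F 0F ∷ B∶C 2F 1F ∷ X∶s ∷ B∶s 2F ∷ []) refl refl
      ; cut-B₀ = boundary-zero-or-k (B 0F) (X∶B 0F ∷ B∶C 0F 1F ∷ B∶C 0F 2F ∷ B∶s 0F ∷ [])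
                   1F refl (v∉B 0F refl) refl refl
      ; cut-B₁ = boundary-zero-or-k (B 1F) (X∶B 1F ∷ B∶C 1F 0F ∷ B∶C 1F 2F ∷ B∶s 1F ∷ [])
                   0F refl (v∉B 1F refl) refl refl
      ; cut-B₂ = boundary-zero-or-k (B 2F) (X∶B 2F ∷ B∶C 2F 0F ∷ B∶C 2F 1F ∷ B∶s 2F ∷ [])
                   0F refl (v∉B 2F refl) refl refl
      ; cut-A₀ = ≤-trans (count-≤ (X∶B 0F ∷ B∶C 2F 1F ∷ B∶C 1F 2F ∷ X∶s ∷ B∶s 1F ∷ B∶s 2F ∷ [])
                                  (between (inA 0F) (not ∘ inA 0F) ∷ []) refl) δA₀≤
      ; single₀ = at-most-one-neighbour 1F 2F (λ ()) X (B 0F) refl refl refl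
      ; single₁ = at-most-one-neighbour 0F 2F (λ ()) X (B 1F) refl refl refl
      ; single₂ = at-most-one-neighbour 0F 1F (λ ()) X (B 2F) refl refl refl
      }

odd⇒≡1+2h : ∀ k → k % 2 ≡ 1 → k ≡ suc ((k ∸ 1) / 2 + (k ∸ 1) / 2)
odd⇒≡1+2h k k-odd = begin
  k                               ≡⟨ k≡1+[k/2]*2 ⟩
  suc (k / 2 * 2)                 ≡⟨ cong suc (double (k / 2)) ⟩
  suc (k / 2 + k / 2)             ≡⟨ cong (λ q → suc (q + q)) [k∸1]/2≡k/2 ⟨
  suc (h + h)                     ∎
  where
  open ≡-Reasoning
  h = (k ∸ 1) / 2
  k≡1+[k/2]*2 : k ≡ suc (k / 2 * 2)
  k≡1+[k/2]*2 = trans (m≡m%n+[m/n]*n k 2) (cong (_+ k / 2 * 2) k-odd)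
  [k∸1]/2≡k/2 : (k ∸ 1) / 2 ≡ k / 2
  [k∸1]/2≡k/2 = trans (cong (λ m → (m ∸ 1) / 2) k≡1+[k/2]*2) (m*n/n≡m (k / 2) 2)
  double : ∀ q → q * 2 ≡ q + q
  double = solve-∀

3≤1+2h⇒1≤h : ∀ h → 3 ≤ suc (h + h) → 1 ≤ h
3≤1+2h⇒1≤h zero    (s≤s ())
3≤1+2h⇒1≤h (suc h) _ = s≤s z≤n

lemma4p1 : (G : Graph) (s : Fin (Graph.n G)) (k : ℕ) →
    IsSKEdgeConnected G s k → 3 ≤ k → k % 2 ≡ 1 →
    (A : Fin 3 → Subset (Graph.n G)) →
    (∀ i → Dangerous G s k (A i)) →
    (∀ i j → i ≢ j → A i ≢ A j) →
    (∀ i j → i ≢ j →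
      (∀ u v → u ∈ (A i ∩ A j) → v ∈ (A i ∩ A j) →
        Adjacent G s u → Adjacent G s v → u ≡ v)
      × edgesBetween G (A i ∩ A j) (A j ─ A i) ≡ (k ∸ 1) / 2
      × edgesBetween G (A i ─ A j) (A j ─ A i) ≡ 0
      × edgesBetween G (A i ∩ A j) (∁ (A i ∪ A j ∪ ⁅ s ⁆)) ≡ 0) →
    ∀ v → v ∉ (A Fin.zero ∩ A (Fin.suc Fin.zero) ∩ A (Fin.suc (Fin.suc Fin.zero)))
lemma4p1 G s k conn 3≤k k-odd A dangerous _ hyp v v∈⋂ =
  no-configuration (Bounds.configuration h (3≤1+2h⇒1≤h h (subst (3 ≤_) k≡1+2h 3≤k))
    (subst (IsSKEdgeConnected G s) k≡1+2h conn)
    (λ i j i≢j → proj₁ (hyp i j i≢j))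
    (λ i j i≢j → trans (sym (edgesBetween-shared-only i j)) (proj₁ (proj₂ (hyp i j i≢j))))
    (λ i j i≢j → trans (sym (edgesBetween-only-only i j)) (proj₁ (proj₂ (proj₂ (hyp i j i≢j)))))
    (λ i j i≢j → trans (sym (edgesBetween-shared-outside i j)) (proj₂ (proj₂ (proj₂ (hyp i j i≢j)))))
    (subst₂ _≤_ δ-A₀ (trans (+-comm k 1) (cong suc k≡1+2h)) (proj₂ (proj₂ (proj₂ (dangerous 0F)))))
    (∈⋂⇒X v∈⋂) (proj₁ (proj₂ outside-A₀)) (∉⇒lookup≡false (proj₂ (proj₂ outside-A₀))))
  where
  h = (k ∸ 1) / 2
  k≡1+2h = odd⇒≡1+2h k k-odd
  open ThreeSets G s A (proj₁ ∘ dangerous)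
  outside-A₀ = proj₁ (proj₂ (proj₂ (dangerous 0F)))
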